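{- Let $m\geqslant 2$ and $i\in\{0,1,\ldots,m-1\}$. For every integer $k\geqslant 2$, \[ r_\mathcal{M}(i,m,k)=\sum_{\substack{l=0\\ \gcd(l,m)\mid\gcd(i,m)}}^{m-1} r_\mathcal{M}(l,m,k-1)\gcd(l,m). \] Moreover, $r_\mathcal{M}(i,m,1)=0$ if $i\neq 1$ and $r_\mathcal{M}(1,m,1)=m$.
   Context: $\mathbb{N}=\{0,1,2,\ldots\}$; $\gcd(0,m)=m$. Let $\mathcal{M}=(m^{j-1})_{j\in\mathbb{N}_+}$ and let $p_\mathcal{M}(n,k)$ be the number of tuples $(x_1,\ldots,x_k)\in\mathbb{N}^k$ with $x_1+mx_2+\cdots+m^{k-1}x_k=n$. For integers $k\ge1$ and $i$, define $r_\mathcal{M}(i,m,k)=\#\{n\in\{0,1,\ldots,m^k-1\}:\ p_\mathcal{M}(n,k)\equiv i\pmod{m}\}$. -}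

module Defs where

open import Data.Nat using (ℕ; zero; suc; _+_; _*_; _^_; _%_; NonZero; _≟_)
open import Data.Nat.Divisibility using (_∣?_)
open import Data.Nat.GCD using (gcd)
open import Data.List using (List; []; _∷_; map; concatMap; filter; length; upTo)
open import Data.Nat.ListAction using (sum)
open import Data.Vec using (Vec; []; _∷_)

box : (k b : ℕ) → List (Vec ℕ k)
box zero    b = [] ∷ []
box (suc k) b = concatMap (λ x → map (x ∷_) (box k b)) (upTo b)

wsum : ∀ {k} → ℕ → ℕ → Vec ℕ k → ℕ
wsum m w []       = 0
wsum m w (x ∷ xs) = w * x + wsum m (w * m) xs

-- p_M(n,k) = #{(x₁,…,x_k) ∈ ℕ^k : x₁ + m x₂ + … + m^(k-1) x_k = n}.
-- For m ≥ 1 every such tuple has all xⱼ ≤ n, so it suffices to count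
-- within the box {0,…,n}^k.
pM : (m n k : ℕ) → ℕ
pM m n k = length (filter (λ v → wsum m 1 v ≟ n) (box k (suc n)))

rM : (i m k : ℕ) → .{{NonZero m}} → ℕ
rM i m k = length (filter (λ n → pM m n k % m ≟ i % m) (upTo (m ^ k)))

rhsSum : (i m k' : ℕ) → .{{NonZero m}} → ℕ
rhsSum i m k' = sum (map (λ l → rM l m k' * gcd l m)
                         (filter (λ l → gcd l m ∣? gcd i m) (upTo m)))

{-# OPTIONS --safe #-}
module Submission where

-- Write p_k(n) = p_M(n,k) and S_k(q) = Σ_{t ≤ q} p_k(t). Splitting off x₁ gives p_{k+1}(n) = S_k(⌊n/m⌋),
-- so p_{k+1} is constant on each block {qm, …, qm + m − 1}, and
-- S_{k+1}(am + b) = m Σ_{q<a} S_k(q) + (b+1) S_k(a) ≡ (b+1) S_k(a) (mod m).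
-- Hence r_M(i,m,k+2) = m Σ_{a<m^k} #{y < m : y S_k(a) ≡ i (mod m)}. A congruence y c ≡ i (mod m) has
-- gcd(c,m) solutions if gcd(c,m) ∣ gcd(i,m) and none otherwise, so regrouping the right-hand side by n
-- instead of l turns it into Σ_{n<m^{k+1}} #{y < m : y p_{k+1}(n) ≡ i (mod m)}, which by blockwise
-- constancy is the same sum.

open import Defs
open import Data.Nat
open import Data.Nat.Properties
open import Data.Nat.DivMod
open import Data.Nat.Divisibility
open import Data.Nat.GCD
open import Data.Nat.Coprimality using (Coprime; coprime-Bézout; coprime-/gcd)
open import Data.Nat.ListAction using (sum)
open import Data.Nat.Tactic.RingSolver using (solve-∀)
open import Data.Bool using (if_then_else_)
open import Data.List using (List; []; _∷_; map; concat; filter; length; upTo; applyUpTo; _++_)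
open import Data.Vec using (Vec; []; _∷_)
open import Data.Product using (_×_; ∃; _,_)
open import Data.Sum using (inj₂)
open import Data.Empty using (⊥-elim)
open import Function using (_∘_)
open import Relation.Nullary using (Dec; yes; no; does; ¬_)
open import Relation.Unary using (Pred; Decidable)
open import Relation.Binary.PropositionalEquality

-- Opaque because unfolding `does (x ≟ y)` defeats the higher-order unification of summands.
opaque
  𝟙 : ∀ {A : Set} → Dec A → ℕ
  𝟙 d = if does d then 1 else 0

  𝟙-yes : ∀ {A : Set} → A → (d : Dec A) → 𝟙 d ≡ 1
  𝟙-yes a (yes _) = refl
  𝟙-yes a (no ¬a) = ⊥-elim (¬a a)

  𝟙-no : ∀ {A : Set} → ¬ A → (d : Dec A) → 𝟙 d ≡ 0
  𝟙-no ¬a (yes a) = ⊥-elim (¬a a)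
  𝟙-no ¬a (no _)  = refl

𝟙-cong : ∀ {A B : Set} → (A → B) → (B → A) → (a : Dec A) (b : Dec B) → 𝟙 a ≡ 𝟙 b
𝟙-cong f g (yes a) b = trans (𝟙-yes a (yes a)) (sym (𝟙-yes (f a) b))
𝟙-cong f g (no ¬a) b = trans (𝟙-no ¬a (no ¬a)) (sym (𝟙-no (¬a ∘ g) b))

Σ< : ℕ → (ℕ → ℕ) → ℕ
Σ< zero    f = 0
Σ< (suc n) f = f 0 + Σ< n (λ j → f (suc j))

Σ<-cong : ∀ n {f g : ℕ → ℕ} → (∀ j → j < n → f j ≡ g j) → Σ< n f ≡ Σ< n g
Σ<-cong zero    h = refl
Σ<-cong (suc n) h = cong₂ _+_ (h 0 z<s) (Σ<-cong n (λ j j<n → h (suc j) (s<s j<n)))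

Σ<-≡0 : ∀ n {f : ℕ → ℕ} → (∀ j → j < n → f j ≡ 0) → Σ< n f ≡ 0
Σ<-≡0 zero    h = refl
Σ<-≡0 (suc n) h = cong₂ _+_ (h 0 z<s) (Σ<-≡0 n (λ j j<n → h (suc j) (s<s j<n)))

Σ<-const : ∀ n c → Σ< n (λ _ → c) ≡ n * c
Σ<-const zero    c = refl
Σ<-const (suc n) c = cong (c +_) (Σ<-const n c)

Σ<-distrib-+ : ∀ n (f g : ℕ → ℕ) → Σ< n (λ j → f j + g j) ≡ Σ< n f + Σ< n g
Σ<-distrib-+ zero    f g = refl
Σ<-distrib-+ (suc n) f g =
  trans (cong (f 0 + g 0 +_) (Σ<-distrib-+ n _ _)) (+-interchange (f 0) (g 0) _ _)
  where
  +-interchange : ∀ a b c d → a + b + (c + d) ≡ a + c + (b + d)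
  +-interchange = solve-∀

*-distribˡ-Σ< : ∀ n c (f : ℕ → ℕ) → c * Σ< n f ≡ Σ< n (λ j → c * f j)
*-distribˡ-Σ< zero    c f = *-zeroʳ c
*-distribˡ-Σ< (suc n) c f =
  trans (*-distribˡ-+ c (f 0) _) (cong (c * f 0 +_) (*-distribˡ-Σ< n c _))

*-distribʳ-Σ< : ∀ n c (f : ℕ → ℕ) → Σ< n f * c ≡ Σ< n (λ j → f j * c)
*-distribʳ-Σ< zero    c f = refl
*-distribʳ-Σ< (suc n) c f =
  trans (*-distribʳ-+ c (f 0) _) (cong (f 0 * c +_) (*-distribʳ-Σ< n c _))

Σ<-split : ∀ a b (f : ℕ → ℕ) → Σ< (a + b) f ≡ Σ< a f + Σ< b (λ j → f (a + j))
Σ<-split zero    b f = refl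
Σ<-split (suc a) b f = trans (cong (f 0 +_) (Σ<-split a b _)) (sym (+-assoc (f 0) _ _))

Σ<-blocks : ∀ a b (f : ℕ → ℕ) → Σ< (a * b) f ≡ Σ< a (λ q → Σ< b (λ r → f (q * b + r)))
Σ<-blocks zero    b f = refl
Σ<-blocks (suc a) b f = trans (Σ<-split b (a * b) f) (cong (Σ< b f +_) (begin
    Σ< (a * b) (λ j → f (b + j))
  ≡⟨ Σ<-blocks a b _ ⟩
    Σ< a (λ q → Σ< b (λ r → f (b + (q * b + r))))
  ≡⟨ Σ<-cong a (λ q _ → Σ<-cong b (λ r _ → cong f (sym (+-assoc b (q * b) r)))) ⟩
    Σ< a (λ q → Σ< b (λ r → f (suc q * b + r)))
  ∎))
  where open ≡-Reasoning

Σ<-swap : ∀ a b (f : ℕ → ℕ → ℕ) →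
          Σ< a (λ x → Σ< b (λ y → f x y)) ≡ Σ< b (λ y → Σ< a (λ x → f x y))
Σ<-swap zero    b f = sym (Σ<-≡0 b (λ _ _ → refl))
Σ<-swap (suc a) b f = trans (cong (Σ< b (f 0) +_) (Σ<-swap a b _)) (sym (Σ<-distrib-+ b _ _))

Σ<-snoc : ∀ n (f : ℕ → ℕ) → Σ< (suc n) f ≡ Σ< n f + f n
Σ<-snoc zero    f = +-comm (f 0) 0
Σ<-snoc (suc n) f = trans (cong (f 0 +_) (Σ<-snoc n _)) (sym (+-assoc (f 0) _ _))

Σ<-rotate : ∀ n (f : ℕ → ℕ) → f n ≡ f 0 → Σ< n (λ j → f (suc j)) ≡ Σ< n f
Σ<-rotate n f fn≡f0 = +-cancelˡ-≡ (f 0) _ _ (begin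
  f 0 + Σ< n (λ j → f (suc j)) ≡⟨ Σ<-snoc n f ⟩
  Σ< n f + f n                 ≡⟨ cong (Σ< n f +_) fn≡f0 ⟩
  Σ< n f + f 0                 ≡⟨ +-comm _ (f 0) ⟩
  f 0 + Σ< n f                 ∎)
  where open ≡-Reasoning

Σ<-single : ∀ n w (f : ℕ → ℕ) → w < n → (∀ j → j < n → j ≢ w → f j ≡ 0) → Σ< n f ≡ f w
Σ<-single (suc n) zero f _ h =
  trans (cong (f 0 +_) (Σ<-≡0 n (λ j j<n → h (suc j) (s<s j<n) (λ ())))) (+-identityʳ (f 0))
Σ<-single (suc n) (suc w) f (s<s w<n) h =
  trans (cong (_+ Σ< n (λ j → f (suc j))) (h 0 z<s (λ ())))
        (Σ<-single n w (λ j → f (suc j)) w<n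
          (λ j j<n j≢w → h (suc j) (s<s j<n) (j≢w ∘ suc-injective)))

Σ<-select : ∀ n w (f : ℕ → ℕ) → w < n → Σ< n (λ t → f t * 𝟙 (w ≟ t)) ≡ f w
Σ<-select n w f w<n =
  trans (Σ<-single n w _ w<n (λ j _ j≢w → trans (cong (f j *_) (𝟙-no (j≢w ∘ sym) (w ≟ j))) (*-zeroʳ (f j))))
        (trans (cong (f w *_) (𝟙-yes refl (w ≟ w))) (*-identityʳ (f w)))

Σ<-select-≥ : ∀ n w (f : ℕ → ℕ) → n ≤ w → Σ< n (λ t → f t * 𝟙 (w ≟ t)) ≡ 0
Σ<-select-≥ n w f n≤w = Σ<-≡0 n (λ t t<n →
  trans (cong (f t *_) (𝟙-no (λ w≡t → <⇒≱ t<n (subst (n ≤_) w≡t n≤w)) (w ≟ t))) (*-zeroʳ (f t)))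

Σ<-truncate : ∀ B q (f : ℕ → ℕ) → q < B → Σ< B (λ t → 𝟙 (t ≤? q) * f t) ≡ Σ< (suc q) f
Σ<-truncate B q f q<B = begin
    Σ< B (λ t → 𝟙 (t ≤? q) * f t)
  ≡⟨ cong (λ z → Σ< z (λ t → 𝟙 (t ≤? q) * f t)) (sym (m+[n∸m]≡n q<B)) ⟩
    Σ< (suc q + (B ∸ suc q)) (λ t → 𝟙 (t ≤? q) * f t)
  ≡⟨ Σ<-split (suc q) (B ∸ suc q) (λ t → 𝟙 (t ≤? q) * f t) ⟩
    Σ< (suc q) (λ t → 𝟙 (t ≤? q) * f t) + Σ< (B ∸ suc q) (λ j → 𝟙 (suc q + j ≤? q) * f (suc q + j))
  ≡⟨ cong₂ _+_ (Σ<-cong (suc q) {λ t → 𝟙 (t ≤? q) * f t} (λ t t≤q → trans (cong (_* f t) (𝟙-yes (≤-pred t≤q) (t ≤? q))) (+-identityʳ (f t))))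
               (Σ<-≡0 (B ∸ suc q) {λ j → 𝟙 (suc q + j ≤? q) * f (suc q + j)} (λ j _ → cong (_* f (suc q + j)) (𝟙-no (<⇒≱ (s≤s (m≤m+n q j))) (suc q + j ≤? q)))) ⟩
    Σ< (suc q) f + 0
  ≡⟨ +-identityʳ _ ⟩
    Σ< (suc q) f
  ∎
  where open ≡-Reasoning

sumBy : ∀ {A : Set} → (A → ℕ) → List A → ℕ
sumBy f []       = 0
sumBy f (x ∷ xs) = f x + sumBy f xs

sumBy-++ : ∀ {A : Set} (f : A → ℕ) xs ys → sumBy f (xs ++ ys) ≡ sumBy f xs + sumBy f ys
sumBy-++ f []       ys = refl
sumBy-++ f (x ∷ xs) ys = trans (cong (f x +_) (sumBy-++ f xs ys)) (sym (+-assoc (f x) _ _))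

sumBy-concat : ∀ {A : Set} (f : A → ℕ) xss → sumBy f (concat xss) ≡ sumBy (sumBy f) xss
sumBy-concat f []         = refl
sumBy-concat f (xs ∷ xss) = trans (sumBy-++ f xs (concat xss)) (cong (sumBy f xs +_) (sumBy-concat f xss))

sumBy-map : ∀ {A B : Set} (f : B → ℕ) (g : A → B) xs → sumBy f (map g xs) ≡ sumBy (f ∘ g) xs
sumBy-map f g []       = refl
sumBy-map f g (x ∷ xs) = cong (f (g x) +_) (sumBy-map f g xs)

sumBy-applyUpTo : ∀ {A : Set} (f : A → ℕ) (g : ℕ → A) n → sumBy f (applyUpTo g n) ≡ Σ< n (f ∘ g)
sumBy-applyUpTo f g zero    = refl
sumBy-applyUpTo f g (suc n) = cong (f (g 0) +_) (sumBy-applyUpTo f (g ∘ suc) n)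

length-filter : ∀ {A : Set} {P : Pred A _} (P? : Decidable P) xs →
                length (filter P? xs) ≡ sumBy (𝟙 ∘ P?) xs
length-filter P? []       = refl
length-filter P? (x ∷ xs) with P? x
... | yes p = trans (cong suc (length-filter P? xs)) (cong (_+ _) (sym (𝟙-yes p (yes p))))
... | no ¬p = trans (length-filter P? xs) (cong (_+ _) (sym (𝟙-no ¬p (no ¬p))))

sum-map-filter : ∀ {A : Set} {P : Pred A _} (P? : Decidable P) (f : A → ℕ) xs →
                 sum (map f (filter P? xs)) ≡ sumBy (λ x → 𝟙 (P? x) * f x) xs
sum-map-filter P? f []       = refl
sum-map-filter P? f (x ∷ xs) with P? x
... | yes p = cong₂ _+_ (trans (sym (+-identityʳ (f x))) (cong (_* f x) (sym (𝟙-yes p (yes p)))))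
                        (sum-map-filter P? f xs)
... | no ¬p = trans (sum-map-filter P? f xs) (cong (λ z → z * f x + _) (sym (𝟙-no ¬p (no ¬p))))

module Partitions (m : ℕ) .{{_ : NonZero m}} where

  -- Sorting the tuples by t = x₂ + m x₃ + ⋯ : then x₁ = n ∸ m t is forced and t ranges over 0 … ⌊n/m⌋.
  partitions : ℕ → ℕ → ℕ
  partitions zero    n = 𝟙 (0 ≟ n)
  partitions (suc k) n = Σ< (suc (n / m)) (partitions k)

  weight : ∀ {k} → Vec ℕ k → ℕ
  weight = wsum m 1

  wsum-scale : ∀ {k} w (v : Vec ℕ k) → wsum m w v ≡ w * weight v
  wsum-scale w []       = sym (*-zeroʳ w)
  wsum-scale w (x ∷ xs) = begin
    w * x + wsum m (w * m) xs       ≡⟨ cong (w * x +_) (wsum-scale (w * m) xs) ⟩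
    w * x + w * m * weight xs       ≡⟨ factor w x m (weight xs) ⟩
    w * (1 * x + 1 * m * weight xs) ≡⟨ cong (λ z → w * (1 * x + z)) (sym (wsum-scale (1 * m) xs)) ⟩
    w * weight (x ∷ xs)             ∎
    where
    open ≡-Reasoning
    factor : ∀ w x m y → w * x + w * m * y ≡ w * (1 * x + 1 * m * y)
    factor = solve-∀

  weight-∷ : ∀ {k} x (v : Vec ℕ k) → weight (x ∷ v) ≡ x + m * weight v
  weight-∷ x v = trans (cong (1 * x +_) (wsum-scale (1 * m) v)) (normalise x m (weight v))
    where
    normalise : ∀ x m y → 1 * x + 1 * m * y ≡ x + m * y
    normalise = solve-∀

  sumBy-box-suc : ∀ k B (f : Vec ℕ (suc k) → ℕ) →
                  sumBy f (box (suc k) B) ≡ Σ< B (λ x → sumBy (λ v → f (x ∷ v)) (box k B))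
  sumBy-box-suc k B f = begin
      sumBy f (concat (map (λ x → map (x ∷_) (box k B)) (upTo B)))
    ≡⟨ sumBy-concat f (map (λ x → map (x ∷_) (box k B)) (upTo B)) ⟩
      sumBy (sumBy f) (map (λ x → map (x ∷_) (box k B)) (upTo B))
    ≡⟨ sumBy-map (sumBy f) _ (upTo B) ⟩
      sumBy (λ x → sumBy f (map (x ∷_) (box k B))) (upTo B)
    ≡⟨ sumBy-applyUpTo _ (λ x → x) B ⟩
      Σ< B (λ x → sumBy f (map (x ∷_) (box k B)))
    ≡⟨ Σ<-cong B (λ x _ → sumBy-map f (x ∷_) (box k B)) ⟩
      Σ< B (λ x → sumBy (λ v → f (x ∷ v)) (box k B))
    ∎
    where open ≡-Reasoning

  boxCount : ℕ → ℕ → ℕ → ℕ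
  boxCount k B n = sumBy (λ v → 𝟙 (weight v ≟ n)) (box k B)

  𝟙-weight-∷ : ∀ {k} B n x (v : Vec ℕ k) → n < B →
               𝟙 (weight (x ∷ v) ≟ n) ≡ Σ< B (λ t → 𝟙 (x + m * t ≟ n) * 𝟙 (weight v ≟ t))
  𝟙-weight-∷ B n x v n<B with weight v <? B
  ... | yes wv<B = begin
    𝟙 (weight (x ∷ v) ≟ n)   ≡⟨ cong (λ z → 𝟙 (z ≟ n)) (weight-∷ x v) ⟩
    𝟙 (x + m * weight v ≟ n) ≡⟨ sym (Σ<-select B (weight v) (λ t → 𝟙 (x + m * t ≟ n)) wv<B) ⟩
    Σ< B (λ t → 𝟙 (x + m * t ≟ n) * 𝟙 (weight v ≟ t)) ∎
    where open ≡-Reasoning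
  ... | no wv≮B = trans (𝟙-no too-heavy _) (sym (Σ<-select-≥ B (weight v) (λ t → 𝟙 (x + m * t ≟ n)) (≮⇒≥ wv≮B)))
    where
    too-heavy : weight (x ∷ v) ≢ n
    too-heavy w≡n = <⇒≱ n<B (begin
      B                  ≤⟨ ≮⇒≥ wv≮B ⟩
      weight v           ≤⟨ m≤n*m (weight v) m ⟩
      m * weight v       ≤⟨ m≤n+m (m * weight v) x ⟩
      x + m * weight v   ≡⟨ sym (weight-∷ x v) ⟩
      weight (x ∷ v)     ≡⟨ w≡n ⟩
      n                  ∎)
      where open ≤-Reasoning

  sumBy-𝟙-weight-∷ : ∀ {k} B n x (vs : List (Vec ℕ k)) → n < B →
    sumBy (λ v → 𝟙 (weight (x ∷ v) ≟ n)) vs ≡ Σ< B (λ t → 𝟙 (x + m * t ≟ n) * sumBy (λ v → 𝟙 (weight v ≟ t)) vs)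
  sumBy-𝟙-weight-∷ B n x [] n<B =
    sym (Σ<-≡0 B {λ t → 𝟙 (x + m * t ≟ n) * 0} (λ t _ → *-zeroʳ (𝟙 (x + m * t ≟ n))))
  sumBy-𝟙-weight-∷ B n x (v ∷ vs) n<B = begin
      𝟙 (weight (x ∷ v) ≟ n) + sumBy (λ u → 𝟙 (weight (x ∷ u) ≟ n)) vs
    ≡⟨ cong₂ _+_ (𝟙-weight-∷ B n x v n<B) (sumBy-𝟙-weight-∷ B n x vs n<B) ⟩
      Σ< B (λ t → 𝟙 (x + m * t ≟ n) * 𝟙 (weight v ≟ t)) + Σ< B (λ t → 𝟙 (x + m * t ≟ n) * sumBy (λ u → 𝟙 (weight u ≟ t)) vs)
    ≡⟨ sym (Σ<-distrib-+ B _ _) ⟩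
      Σ< B (λ t → 𝟙 (x + m * t ≟ n) * 𝟙 (weight v ≟ t) + 𝟙 (x + m * t ≟ n) * sumBy (λ u → 𝟙 (weight u ≟ t)) vs)
    ≡⟨ Σ<-cong B (λ t _ → sym (*-distribˡ-+ (𝟙 (x + m * t ≟ n)) _ _)) ⟩
      Σ< B (λ t → 𝟙 (x + m * t ≟ n) * sumBy (λ u → 𝟙 (weight u ≟ t)) (v ∷ vs))
    ∎
    where open ≡-Reasoning

  m*t≤n⇒t≤n/m : ∀ t n → m * t ≤ n → t ≤ n / m
  m*t≤n⇒t≤n/m t n le = subst (_≤ n / m) (m*n/n≡m t m) (/-monoˡ-≤ m (subst (_≤ n) (*-comm m t) le))

  t≤n/m⇒m*t≤n : ∀ t n → t ≤ n / m → m * t ≤ n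
  t≤n/m⇒m*t≤n t n le = ≤-trans (*-monoʳ-≤ m le) (≤-trans (≤-reflexive (*-comm m (n / m))) (m/n*n≤m n m))

  Σ<-𝟙-x+m*t≡n : ∀ B n t → n < B → Σ< B (λ x → 𝟙 (x + m * t ≟ n)) ≡ 𝟙 (t ≤? n / m)
  Σ<-𝟙-x+m*t≡n B n t n<B with m * t ≤? n
  ... | yes le = trans
    (Σ<-single B (n ∸ m * t) _ (≤-<-trans (m∸n≤m n (m * t)) n<B)
      (λ x _ x≢ → 𝟙-no (λ e → x≢ (trans (sym (m+n∸n≡m x (m * t))) (cong (_∸ m * t) e))) _))
    (trans (𝟙-yes (m∸n+n≡m le) _) (sym (𝟙-yes (m*t≤n⇒t≤n/m t n le) _)))
  ... | no nle = trans
    (Σ<-≡0 B {λ x → 𝟙 (x + m * t ≟ n)} (λ x _ → 𝟙-no (λ e → nle (subst (m * t ≤_) e (m≤n+m (m * t) x))) _))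
    (sym (𝟙-no (nle ∘ t≤n/m⇒m*t≤n t n) _))

  boxCount-suc : ∀ k B n → n < B → boxCount (suc k) B n ≡ Σ< (suc (n / m)) (boxCount k B)
  boxCount-suc k B n n<B = begin
      boxCount (suc k) B n
    ≡⟨ sumBy-box-suc k B (λ v → 𝟙 (weight v ≟ n)) ⟩
      Σ< B (λ x → sumBy (λ v → 𝟙 (weight (x ∷ v) ≟ n)) (box k B))
    ≡⟨ Σ<-cong B (λ x _ → sumBy-𝟙-weight-∷ B n x (box k B) n<B) ⟩
      Σ< B (λ x → Σ< B (λ t → 𝟙 (x + m * t ≟ n) * boxCount k B t))
    ≡⟨ Σ<-swap B B _ ⟩
      Σ< B (λ t → Σ< B (λ x → 𝟙 (x + m * t ≟ n) * boxCount k B t))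
    ≡⟨ Σ<-cong B (λ t _ → trans (sym (*-distribʳ-Σ< B (boxCount k B t) _))
                                (cong (_* boxCount k B t) (Σ<-𝟙-x+m*t≡n B n t n<B))) ⟩
      Σ< B (λ t → 𝟙 (t ≤? n / m) * boxCount k B t)
    ≡⟨ Σ<-truncate B (n / m) (boxCount k B) (≤-<-trans (m/n≤m n m) n<B) ⟩
      Σ< (suc (n / m)) (boxCount k B)
    ∎
    where open ≡-Reasoning

  boxCount≡partitions : ∀ k B n → n < B → boxCount k B n ≡ partitions k n
  boxCount≡partitions zero    B n n<B = +-identityʳ _
  boxCount≡partitions (suc k) B n n<B = trans (boxCount-suc k B n n<B)
    (Σ<-cong (suc (n / m)) (λ t t≤n/m → boxCount≡partitions k B t (<-≤-trans (s≤s (≤-trans (≤-pred t≤n/m) (m/n≤m n m))) n<B)))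

  pM≡partitions : ∀ n k → pM m n k ≡ partitions k n
  pM≡partitions n k = trans (length-filter (λ v → weight v ≟ n) (box k (suc n)))
                            (boxCount≡partitions k (suc n) n ≤-refl)

*-cong-% : ∀ n .{{_ : NonZero n}} k {a b} → a % n ≡ b % n → (k * a) % n ≡ (k * b) % n
*-cong-% n k {a} {b} a≡b = begin
  (k * a) % n               ≡⟨ %-distribˡ-* k a n ⟩
  ((k % n) * (a % n)) % n   ≡⟨ cong (λ z → ((k % n) * z) % n) a≡b ⟩
  ((k % n) * (b % n)) % n   ≡⟨ sym (%-distribˡ-* k b n) ⟩
  (k * b) % n               ∎
  where open ≡-Reasoning

[m%n*k]%n≡[m*k]%n : ∀ a n .{{_ : NonZero n}} k → ((a % n) * k) % n ≡ (a * k) % n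
[m%n*k]%n≡[m*k]%n a n k = begin
  ((a % n) * k) % n   ≡⟨ cong (_% n) (*-comm (a % n) k) ⟩
  (k * (a % n)) % n   ≡⟨ *-cong-% n k (m%n%n≡m%n a n) ⟩
  (k * a) % n         ≡⟨ cong (_% n) (*-comm k a) ⟩
  (a * k) % n         ∎
  where open ≡-Reasoning

coprime⇒inverse : ∀ c n .{{_ : NonZero n}} → Coprime c n → ∃ λ u → (u * c) % n ≡ 1 % n
coprime⇒inverse c (suc t) cop with coprime-Bézout cop
... | Bézout.+- x y eq = x , trans (cong (_% suc t) (sym eq)) ([m+kn]%n≡m%n 1 y (suc t))
... | Bézout.-+ x y eq = x * t , (begin
    (x * t * c) % suc t                 ≡⟨ sym ([m+n]%n≡m%n (x * t * c) (suc t)) ⟩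
    (x * t * c + suc t) % suc t         ≡⟨ cong (_% suc t) (rearrange₁ x t c) ⟩
    (t * (1 + x * c) + 1) % suc t       ≡⟨ cong (λ z → (t * z + 1) % suc t) eq ⟩
    (t * (y * suc t) + 1) % suc t       ≡⟨ cong (_% suc t) (rearrange₂ t y) ⟩
    (1 + t * y * suc t) % suc t         ≡⟨ [m+kn]%n≡m%n 1 (t * y) (suc t) ⟩
    1 % suc t                           ∎)
  where
  open ≡-Reasoning
  rearrange₁ : ∀ x t c → x * t * c + suc t ≡ t * (1 + x * c) + 1
  rearrange₁ = solve-∀
  rearrange₂ : ∀ t y → t * (y * suc t) + 1 ≡ 1 + t * y * suc t
  rearrange₂ = solve-∀

congruenceSolutions : ∀ n .{{_ : NonZero n}} → ℕ → ℕ → ℕ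
congruenceSolutions n c i = Σ< n (λ y → 𝟙 ((y * c) % n ≟ i))

coprime⇒congruenceSolutions≡1 : ∀ c n .{{_ : NonZero n}} i → Coprime c n → i < n →
                                congruenceSolutions n c i ≡ 1
coprime⇒congruenceSolutions≡1 c n i cop i<n with coprime⇒inverse c n cop
... | u , uc≡1 = trans
  (Σ<-single n w _ (m%n<n (u * i) n) (λ y y<n y≢w → 𝟙-no (y≢w ∘ solution-unique y y<n) _))
  (𝟙-yes w-solves _)
  where
  open ≡-Reasoning
  w = (u * i) % n
  i%n≡i : i % n ≡ i
  i%n≡i = m<n⇒m%n≡m i<n
  swap-middle : ∀ r u c → r * (u * c) ≡ u * (r * c)
  swap-middle = solve-∀
  reassociate : ∀ u i c → u * i * c ≡ i * (u * c)
  reassociate = solve-∀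
  solution-unique : ∀ y → y < n → (y * c) % n ≡ i → y ≡ w
  solution-unique y y<n yc≡i = begin
    y                  ≡⟨ sym (m<n⇒m%n≡m y<n) ⟩
    y % n              ≡⟨ cong (_% n) (sym (*-identityʳ y)) ⟩
    (y * 1) % n        ≡⟨ sym (*-cong-% n y uc≡1) ⟩
    (y * (u * c)) % n  ≡⟨ cong (_% n) (swap-middle y u c) ⟩
    (u * (y * c)) % n  ≡⟨ *-cong-% n u (trans yc≡i (sym i%n≡i)) ⟩
    w                  ∎
  w-solves : (w * c) % n ≡ i
  w-solves = begin
    ((u * i) % n * c) % n ≡⟨ [m%n*k]%n≡[m*k]%n (u * i) n c ⟩
    (u * i * c) % n       ≡⟨ cong (_% n) (reassociate u i c) ⟩
    (i * (u * c)) % n     ≡⟨ *-cong-% n i uc≡1 ⟩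
    (i * 1) % n           ≡⟨ cong (_% n) (*-identityʳ i) ⟩
    i % n                 ≡⟨ i%n≡i ⟩
    i                     ∎

Σ<-multiple-congruence : ∀ g n .{{_ : NonZero n}} c i →
  Σ< (g * n) (λ y → 𝟙 ((y * c) % n ≟ i)) ≡ g * congruenceSolutions n c i
Σ<-multiple-congruence g n c i = begin
    Σ< (g * n) (λ y → 𝟙 ((y * c) % n ≟ i))
  ≡⟨ Σ<-blocks g n _ ⟩
    Σ< g (λ q → Σ< n (λ r → 𝟙 (((q * n + r) * c) % n ≟ i)))
  ≡⟨ Σ<-cong g (λ q _ → Σ<-cong n (λ r _ → cong (λ z → 𝟙 (z ≟ i)) (periodic q r))) ⟩
    Σ< g (λ _ → congruenceSolutions n c i)
  ≡⟨ Σ<-const g _ ⟩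
    g * congruenceSolutions n c i
  ∎
  where
  open ≡-Reasoning
  periodic : ∀ q r → ((q * n + r) * c) % n ≡ (r * c) % n
  expand : ∀ q n r c → (q * n + r) * c ≡ r * c + q * c * n
  expand = solve-∀
  periodic q r = trans (cong (_% n) (expand q n r c)) ([m+kn]%n≡m%n (r * c) (q * c) n)

-- Dividing y c ≡ i (mod m) by g = gcd c m leaves a congruence modulo m / g with a unit coefficient;
-- its unique solution recurs g times among 0 … m − 1.
congruenceSolutions-∣ : ∀ m .{{_ : NonZero m}} c i → i < m → gcd c m ∣ gcd i m →
                        congruenceSolutions m c i ≡ gcd c m
congruenceSolutions-∣ m c i i<m g∣gcd[i,m] = begin
    congruenceSolutions m c i
  ≡⟨ Σ<-cong m (λ y _ → 𝟙-cong (divide y) (multiply y) _ _) ⟩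
    Σ< m (λ y → 𝟙 ((y * c′) % m′ ≟ i′))
  ≡⟨ cong (λ z → Σ< z (λ y → 𝟙 ((y * c′) % m′ ≟ i′))) (trans (sym m′*g≡m) (*-comm m′ g)) ⟩
    Σ< (g * m′) (λ y → 𝟙 ((y * c′) % m′ ≟ i′))
  ≡⟨ Σ<-multiple-congruence g m′ c′ i′ ⟩
    g * congruenceSolutions m′ c′ i′
  ≡⟨ cong (g *_) (coprime⇒congruenceSolutions≡1 c′ m′ i′ (coprime-/gcd c m) i′<m′) ⟩
    g * 1
  ≡⟨ *-identityʳ g ⟩
    g
  ∎
  where
  open ≡-Reasoning
  g = gcd c m
  instance
    g≢0 : NonZero g
    g≢0 = ≢-nonZero (gcd[m,n]≢0 c m (inj₂ (≢-nonZero⁻¹ m)))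
  c′ = c / g
  m′ = m / g
  i′ = i / g
  c′*g≡c : c′ * g ≡ c
  c′*g≡c = m/n*n≡m (gcd[m,n]∣m c m)
  m′*g≡m : m′ * g ≡ m
  m′*g≡m = m/n*n≡m (gcd[m,n]∣n c m)
  i′*g≡i : i′ * g ≡ i
  i′*g≡i = m/n*n≡m (∣-trans g∣gcd[i,m] (gcd[m,n]∣m i m))
  instance
    m′≢0 : NonZero m′
    m′≢0 = ≢-nonZero (λ m′≡0 → ≢-nonZero⁻¹ m (trans (sym m′*g≡m) (cong (_* g) m′≡0)))
    m′*g≢0 : NonZero (m′ * g)
    m′*g≢0 = m*n≢0 m′ g
  i′<m′ : i′ < m′
  i′<m′ = *-cancelʳ-< _ _ _ (subst₂ _<_ (sym i′*g≡i) (sym m′*g≡m) i<m)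
  reassociate : ∀ y c g → y * c * g ≡ y * (c * g)
  reassociate = solve-∀
  scale : ∀ y → (y * c) % m ≡ ((y * c′) % m′) * g
  scale y = sym (begin
    ((y * c′) % m′) * g       ≡⟨ m%n*o≡m*o%[n*o] (y * c′) m′ g ⟩
    (y * c′ * g) % (m′ * g)   ≡⟨ %-congˡ {o = m′ * g} (trans (reassociate y c′ g) (cong (y *_) c′*g≡c)) ⟩
    (y * c) % (m′ * g)        ≡⟨ %-congʳ {o = y * c} m′*g≡m ⟩
    (y * c) % m               ∎)
  divide : ∀ y → (y * c) % m ≡ i → (y * c′) % m′ ≡ i′
  divide y e = *-cancelʳ-≡ _ _ g (trans (sym (scale y)) (trans e (sym i′*g≡i)))
  multiply : ∀ y → (y * c′) % m′ ≡ i′ → (y * c) % m ≡ i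
  multiply y e = trans (scale y) (trans (cong (_* g) e) i′*g≡i)

congruenceSolutions-∤ : ∀ m .{{_ : NonZero m}} c i → ¬ (gcd c m ∣ gcd i m) →
                        congruenceSolutions m c i ≡ 0
congruenceSolutions-∤ m c i g∤gcd[i,m] = Σ<-≡0 m (λ y _ → 𝟙-no (g∤gcd[i,m] ∘ g∣gcd[i,m] y) _)
  where
  g∣gcd[i,m] : ∀ y → (y * c) % m ≡ i → gcd c m ∣ gcd i m
  g∣gcd[i,m] y yc≡i = gcd-greatest
    (subst (gcd c m ∣_) yc≡i (%-presˡ-∣ (∣-trans (gcd[m,n]∣m c m) (n∣m*n y)) (gcd[m,n]∣n c m)))
    (gcd[m,n]∣n c m)

congruenceSolutions≡ : ∀ m .{{_ : NonZero m}} c i → i < m →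
                       congruenceSolutions m c i ≡ 𝟙 (gcd c m ∣? gcd i m) * gcd c m
congruenceSolutions≡ m c i i<m with gcd c m ∣? gcd i m
... | yes g∣ = trans (congruenceSolutions-∣ m c i i<m g∣)
                     (sym (trans (cong (_* gcd c m) (𝟙-yes g∣ (yes g∣))) (+-identityʳ _)))
... | no g∤  = trans (congruenceSolutions-∤ m c i g∤) (cong (_* gcd c m) (sym (𝟙-no g∤ (no g∤))))

congruenceSolutions-% : ∀ m .{{_ : NonZero m}} c i → congruenceSolutions m c i ≡ congruenceSolutions m (c % m) i
congruenceSolutions-% m c i =
  Σ<-cong m (λ y _ → cong (λ z → 𝟙 (z ≟ i)) (sym (*-cong-% m y (m%n%n≡m%n c m))))

module Recurrence (m : ℕ) .{{_ : NonZero m}} where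
  open Partitions m

  cumulative : ℕ → ℕ → ℕ
  cumulative k q = Σ< (suc q) (partitions k)

  [q*m+r]/m≡q : ∀ q r → r < m → (q * m + r) / m ≡ q
  [q*m+r]/m≡q q r r<m = begin
    (q * m + r) / m    ≡⟨ +-distrib-/-∣ˡ r (n∣m*n q) ⟩
    q * m / m + r / m  ≡⟨ cong₂ _+_ (m*n/n≡m q m) (m<n⇒m/n≡0 r<m) ⟩
    q + 0              ≡⟨ +-identityʳ q ⟩
    q                  ∎
    where open ≡-Reasoning

  partitions-suc-block : ∀ k q r → r < m → partitions (suc k) (q * m + r) ≡ cumulative k q
  partitions-suc-block k q r r<m = cong (λ z → Σ< (suc z) (partitions k)) ([q*m+r]/m≡q q r r<m)

  cumulative-suc : ∀ k a b → b < m →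
                   cumulative (suc k) (a * m + b) ≡ m * Σ< a (cumulative k) + suc b * cumulative k a
  cumulative-suc k a b b<m = begin
      Σ< (suc (a * m + b)) (partitions (suc k))
    ≡⟨ cong (λ z → Σ< z (partitions (suc k))) (sym (+-suc (a * m) b)) ⟩
      Σ< (a * m + suc b) (partitions (suc k))
    ≡⟨ Σ<-split (a * m) (suc b) (partitions (suc k)) ⟩
      Σ< (a * m) (partitions (suc k)) + Σ< (suc b) (λ j → partitions (suc k) (a * m + j))
    ≡⟨ cong₂ _+_ full-blocks last-block ⟩
      m * Σ< a (cumulative k) + suc b * cumulative k a
    ∎
    where
    open ≡-Reasoning
    full-blocks : Σ< (a * m) (partitions (suc k)) ≡ m * Σ< a (cumulative k)
    full-blocks = begin
        Σ< (a * m) (partitions (suc k))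
      ≡⟨ Σ<-blocks a m _ ⟩
        Σ< a (λ q → Σ< m (λ r → partitions (suc k) (q * m + r)))
      ≡⟨ Σ<-cong a (λ q _ → trans (Σ<-cong m (partitions-suc-block k q)) (Σ<-const m (cumulative k q))) ⟩
        Σ< a (λ q → m * cumulative k q)
      ≡⟨ sym (*-distribˡ-Σ< a m (cumulative k)) ⟩
        m * Σ< a (cumulative k)
      ∎
    last-block : Σ< (suc b) (λ j → partitions (suc k) (a * m + j)) ≡ suc b * cumulative k a
    last-block = trans (Σ<-cong (suc b) (λ j j≤b → partitions-suc-block k a j (≤-<-trans (≤-pred j≤b) b<m)))
                       (Σ<-const (suc b) (cumulative k a))

  cumulative-suc-% : ∀ k a b → b < m → cumulative (suc k) (a * m + b) % m ≡ (suc b * cumulative k a) % m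
  cumulative-suc-% k a b b<m = trans (cong (_% m) (cumulative-suc k a b b<m))
                                     (%-remove-+ˡ (suc b * cumulative k a) (m∣m*n (Σ< a (cumulative k))))

  Σ<-m^suc : ∀ k (F : ℕ → ℕ) → Σ< (m ^ suc k) F ≡ Σ< (m ^ k) (λ q → Σ< m (λ r → F (q * m + r)))
  Σ<-m^suc k F = trans (cong (λ z → Σ< z F) (*-comm m (m ^ k))) (Σ<-blocks (m ^ k) m F)

  Σ<-m^suc-blockwise : ∀ k (F G : ℕ → ℕ) → (∀ q r → r < m → F (q * m + r) ≡ G q) →
                       Σ< (m ^ suc k) F ≡ Σ< (m ^ k) (λ q → m * G q)
  Σ<-m^suc-blockwise k F G F≡G = trans (Σ<-m^suc k F)
    (Σ<-cong (m ^ k) (λ q _ → trans (Σ<-cong m (F≡G q)) (Σ<-const m (G q))))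

  rM≡Σ< : ∀ l k → l < m → rM l m k ≡ Σ< (m ^ k) (λ n → 𝟙 (partitions k n % m ≟ l))
  rM≡Σ< l k l<m = begin
      rM l m k
    ≡⟨ length-filter (λ n → pM m n k % m ≟ l % m) (upTo (m ^ k)) ⟩
      sumBy (λ n → 𝟙 (pM m n k % m ≟ l % m)) (upTo (m ^ k))
    ≡⟨ sumBy-applyUpTo _ (λ n → n) (m ^ k) ⟩
      Σ< (m ^ k) (λ n → 𝟙 (pM m n k % m ≟ l % m))
    ≡⟨ Σ<-cong (m ^ k) (λ n _ → cong₂ (λ a b → 𝟙 (a % m ≟ b)) (pM≡partitions n k) (m<n⇒m%n≡m l<m)) ⟩
      Σ< (m ^ k) (λ n → 𝟙 (partitions k n % m ≟ l))
    ∎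
    where open ≡-Reasoning

  rM-suc-suc : ∀ i k → i < m →
               rM i m (suc (suc k)) ≡ Σ< (m ^ k) (λ a → m * congruenceSolutions m (cumulative k a) i)
  rM-suc-suc i k i<m = begin
      rM i m (suc (suc k))
    ≡⟨ rM≡Σ< i (suc (suc k)) i<m ⟩
      Σ< (m ^ suc (suc k)) (λ n → 𝟙 (partitions (suc (suc k)) n % m ≟ i))
    ≡⟨ Σ<-m^suc-blockwise (suc k) _ _ (λ q r r<m → cong (λ z → 𝟙 (z % m ≟ i)) (partitions-suc-block (suc k) q r r<m)) ⟩
      Σ< (m ^ suc k) (λ q → m * 𝟙 (cumulative (suc k) q % m ≟ i))
    ≡⟨ Σ<-m^suc k _ ⟩
      Σ< (m ^ k) (λ a → Σ< m (λ b → m * 𝟙 (cumulative (suc k) (a * m + b) % m ≟ i)))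
    ≡⟨ Σ<-cong (m ^ k) (λ a _ → begin
          Σ< m (λ b → m * 𝟙 (cumulative (suc k) (a * m + b) % m ≟ i))
        ≡⟨ Σ<-cong m (λ b b<m → cong (λ z → m * 𝟙 (z ≟ i)) (cumulative-suc-% k a b b<m)) ⟩
          Σ< m (λ b → m * 𝟙 ((suc b * cumulative k a) % m ≟ i))
        ≡⟨ sym (*-distribˡ-Σ< m m _) ⟩
          m * Σ< m (λ b → 𝟙 ((suc b * cumulative k a) % m ≟ i))
        ≡⟨ cong (m *_) (Σ<-rotate m (λ y → 𝟙 ((y * cumulative k a) % m ≟ i)) (top≡bottom (cumulative k a))) ⟩
          m * congruenceSolutions m (cumulative k a) i
        ∎) ⟩
      Σ< (m ^ k) (λ a → m * congruenceSolutions m (cumulative k a) i)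
    ∎
    where
    open ≡-Reasoning
    top≡bottom : ∀ c → 𝟙 ((m * c) % m ≟ i) ≡ 𝟙 ((0 * c) % m ≟ i)
    top≡bottom c = cong (λ z → 𝟙 (z ≟ i))
      (trans (trans (cong (_% m) (*-comm m c)) (m*n%n≡0 c m)) (sym (m<n⇒m%n≡m (>-nonZero⁻¹ m))))

  rhsSum≡Σ<-congruenceSolutions : ∀ i k → i < m →
    rhsSum i m k ≡ Σ< (m ^ k) (λ n → congruenceSolutions m (partitions k n) i)
  rhsSum≡Σ<-congruenceSolutions i k i<m = begin
      rhsSum i m k
    ≡⟨ sum-map-filter (λ l → gcd l m ∣? gcd i m) (λ l → rM l m k * gcd l m) (upTo m) ⟩
      sumBy (λ l → 𝟙 (gcd l m ∣? gcd i m) * (rM l m k * gcd l m)) (upTo m)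
    ≡⟨ sumBy-applyUpTo _ (λ l → l) m ⟩
      Σ< m (λ l → 𝟙 (gcd l m ∣? gcd i m) * (rM l m k * gcd l m))
    ≡⟨ Σ<-cong m (λ l l<m → trans (reorder (𝟙 (gcd l m ∣? gcd i m)) (rM l m k) (gcd l m))
                                  (cong (solutionCount l *_) (rM≡Σ< l k l<m))) ⟩
      Σ< m (λ l → solutionCount l * Σ< (m ^ k) (λ n → 𝟙 (residue n ≟ l)))
    ≡⟨ Σ<-cong m (λ l _ → *-distribˡ-Σ< (m ^ k) (solutionCount l) _) ⟩
      Σ< m (λ l → Σ< (m ^ k) (λ n → solutionCount l * 𝟙 (residue n ≟ l)))
    ≡⟨ Σ<-swap m (m ^ k) _ ⟩
      Σ< (m ^ k) (λ n → Σ< m (λ l → solutionCount l * 𝟙 (residue n ≟ l)))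
    ≡⟨ Σ<-cong (m ^ k) (λ n _ → Σ<-select m (residue n) solutionCount (m%n<n (partitions k n) m)) ⟩
      Σ< (m ^ k) (λ n → solutionCount (residue n))
    ≡⟨ Σ<-cong (m ^ k) (λ n _ → trans (sym (congruenceSolutions≡ m (residue n) i i<m))
                                      (sym (congruenceSolutions-% m (partitions k n) i))) ⟩
      Σ< (m ^ k) (λ n → congruenceSolutions m (partitions k n) i)
    ∎
    where
    open ≡-Reasoning
    solutionCount : ℕ → ℕ
    solutionCount l = 𝟙 (gcd l m ∣? gcd i m) * gcd l m
    residue : ℕ → ℕ
    residue n = partitions k n % m
    reorder : ∀ a r g → a * (r * g) ≡ (a * g) * r
    reorder = solve-∀

  rhsSum-suc : ∀ i k → i < m →
               rhsSum i m (suc k) ≡ Σ< (m ^ k) (λ a → m * congruenceSolutions m (cumulative k a) i)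
  rhsSum-suc i k i<m = trans (rhsSum≡Σ<-congruenceSolutions i (suc k) i<m)
    (Σ<-m^suc-blockwise k _ _ (λ q r r<m → cong (λ z → congruenceSolutions m z i) (partitions-suc-block k q r r<m)))

  rM-1 : ∀ i → 2 ≤ m → i < m → rM i m 1 ≡ m * 𝟙 (1 ≟ i)
  rM-1 i 2≤m i<m = begin
      rM i m 1
    ≡⟨ rM≡Σ< i 1 i<m ⟩
      Σ< (m ^ 1) (λ n → 𝟙 (partitions 1 n % m ≟ i))
    ≡⟨ Σ<-cong (m ^ 1) (λ n _ → cong (λ z → 𝟙 (z % m ≟ i)) (partitions-1 n)) ⟩
      Σ< (m ^ 1) (λ _ → 𝟙 (1 % m ≟ i))
    ≡⟨ Σ<-const (m ^ 1) _ ⟩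
      m ^ 1 * 𝟙 (1 % m ≟ i)
    ≡⟨ cong₂ (λ a b → a * 𝟙 (b ≟ i)) (*-identityʳ m) (m<n⇒m%n≡m 2≤m) ⟩
      m * 𝟙 (1 ≟ i)
    ∎
    where
    open ≡-Reasoning
    partitions-1 : ∀ n → partitions 1 n ≡ 1
    partitions-1 n = cong₂ _+_ (𝟙-yes refl (0 ≟ 0))
                               (Σ<-≡0 (n / m) {λ j → 𝟙 (0 ≟ suc j)} (λ j _ → 𝟙-no (λ ()) (0 ≟ suc j)))

proposition6p9 : (m : ℕ) .{{_ : NonZero m}} → 2 ≤ m → (i : ℕ) → i < m →
    ((k : ℕ) → 2 ≤ k → rM i m k ≡ rhsSum i m (k ∸ 1))
    × (i ≢ 1 → rM i m 1 ≡ 0)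
    × (rM 1 m 1 ≡ m)
proposition6p9 m 2≤m i i<m = recurrence , base-≢1 , base-1
  where
  open Recurrence m
  recurrence : (k : ℕ) → 2 ≤ k → rM i m k ≡ rhsSum i m (k ∸ 1)
  recurrence (suc zero)    (s≤s ())
  recurrence (suc (suc k)) _ = trans (rM-suc-suc i k i<m) (sym (rhsSum-suc i k i<m))
  base-≢1 : i ≢ 1 → rM i m 1 ≡ 0
  base-≢1 i≢1 = trans (rM-1 i 2≤m i<m) (trans (cong (m *_) (𝟙-no (i≢1 ∘ sym) (1 ≟ i))) (*-zeroʳ m))
  base-1 : rM 1 m 1 ≡ m
  base-1 = trans (rM-1 1 2≤m 2≤m) (trans (cong (m *_) (𝟙-yes refl (1 ≟ 1))) (*-identityʳ m))
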